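{- Let $\epsilon>0$ and $\delta>0$ be sufficiently small, and consider nine rectangle item types with (width, height): type 1: $(1/4-300\delta,\,1/6-2\epsilon)$; type 2: $(1/4+100\delta,\,1/6-2\epsilon)$; type 3: $(1/2+200\delta,\,1/6-2\epsilon)$; type 4: $(1/4-30\delta,\,1/3+\epsilon)$; type 5: $(1/4+10\delta,\,1/3+\epsilon)$; type 6: $(1/2+20\delta,\,1/3+\epsilon)$; type 7: $(1/4-3\delta,\,1/2+\epsilon)$; type 8: $(1/4+\delta,\,1/2+\epsilon)$; type 9: $(1/2+2\delta,\,1/2+\epsilon)$. Let $(\lambda_1,\dots,\lambda_9)=\frac{1}{413}(48,48,96,72,72,144,72,72,144)$ and for a pattern $p$ let $w(p)=\sum_{i=2}^{9}\lambda_i p_i$. Then over all patterns $p\in T_6$, the maximum of $w(p)$ is attained by each of the patterns $(0,0,0,0,0,2,2,0,0)$ and $(0,0,0,0,0,1,4,0,0)$.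
   Context: A pattern is a vector $p=(p_1,\dots,p_9)$ of nonnegative integers such that a multiset consisting of $p_i$ items of type $i$ ($i=1,\dots,9$) can be packed into the unit square bin: items placed axis-parallel in the given orientation (no rotation), inside $[0,1]^2$, with pairwise disjoint interiors. $T_j$ denotes the set of patterns whose first nonzero component is $p_j$ (i.e. whose smallest item type index used is $j$).
   Formalization: The parameters ε and δ take rational values, and the items of a pattern are placed in the unit square bin only at rational corner coordinates. -}

module Defs where

open import Data.Nat using (ℕ; zero; suc)
open import Data.Integer using (+_)
open import Data.Rational using (ℚ; 0ℚ; 1ℚ; _+_; _-_; _*_; _/_; _≤_; _<_)
open import Data.Fin using (Fin; zero; suc)
open import Data.Vec using (Vec; []; _∷_; lookup)
open import Data.Product using (Σ; _×_; _,_; ∃-syntax; proj₁)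
open import Data.Sum using (_⊎_)
open import Relation.Binary.PropositionalEquality using (_≡_)
open import Relation.Nullary using (¬_)

ℕ→ℚ : ℕ → ℚ
ℕ→ℚ n = (+ n) / 1

-- the nine item types (indexed 0..8 here, i.e. type i+1 of the paper),
-- widths and heights as functions of ε and δ
width : ℚ → ℚ → Fin 9 → ℚ
width ε δ zero = (+ 1 / 4) - ℕ→ℚ 300 * δ
width ε δ (suc zero) = (+ 1 / 4) + ℕ→ℚ 100 * δ
width ε δ (suc (suc zero)) = (+ 1 / 2) + ℕ→ℚ 200 * δ
width ε δ (suc (suc (suc zero))) = (+ 1 / 4) - ℕ→ℚ 30 * δ
width ε δ (suc (suc (suc (suc zero)))) = (+ 1 / 4) + ℕ→ℚ 10 * δ
width ε δ (suc (suc (suc (suc (suc zero))))) = (+ 1 / 2) + ℕ→ℚ 20 * δ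
width ε δ (suc (suc (suc (suc (suc (suc zero)))))) = (+ 1 / 4) - ℕ→ℚ 3 * δ
width ε δ (suc (suc (suc (suc (suc (suc (suc zero))))))) = (+ 1 / 4) + δ
width ε δ (suc (suc (suc (suc (suc (suc (suc (suc zero)))))))) = (+ 1 / 2) + ℕ→ℚ 2 * δ

height : ℚ → ℚ → Fin 9 → ℚ
height ε δ zero = (+ 1 / 6) - ℕ→ℚ 2 * ε
height ε δ (suc zero) = (+ 1 / 6) - ℕ→ℚ 2 * ε
height ε δ (suc (suc zero)) = (+ 1 / 6) - ℕ→ℚ 2 * ε
height ε δ (suc (suc (suc zero))) = (+ 1 / 3) + ε
height ε δ (suc (suc (suc (suc zero)))) = (+ 1 / 3) + ε
height ε δ (suc (suc (suc (suc (suc zero))))) = (+ 1 / 3) + ε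
height ε δ (suc (suc (suc (suc (suc (suc zero)))))) = (+ 1 / 2) + ε
height ε δ (suc (suc (suc (suc (suc (suc (suc zero))))))) = (+ 1 / 2) + ε
height ε δ (suc (suc (suc (suc (suc (suc (suc (suc zero)))))))) = (+ 1 / 2) + ε

-- a candidate pattern: p_i = lookup p (i-1)
PatVec : Set
PatVec = Vec ℕ 9

-- an item of the multiset: a type i together with a copy index k < p_i
Item : PatVec → Set
Item p = Σ (Fin 9) (λ i → Fin (lookup p i))

-- Packability into [0,1]^2 without rotation: each item gets the position
-- (x , y) of its lower-left corner; items lie inside the unit square and two
-- distinct items have disjoint interiors, i.e. are separated along some axis.
Packable : ℚ → ℚ → PatVec → Set
Packable ε δ p =
  Σ (Item p → ℚ × ℚ) λ pos → ((it : Item p) → InSquare (pos it) (proj₁ it))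
         × ((a b : Item p) → ¬ (a ≡ b) → Separated (pos a) (proj₁ a) (pos b) (proj₁ b))
  where
  InSquare : ℚ × ℚ → Fin 9 → Set
  InSquare (x , y) i = 0ℚ ≤ x × x + width ε δ i ≤ 1ℚ × 0ℚ ≤ y × y + height ε δ i ≤ 1ℚ
  Separated : ℚ × ℚ → Fin 9 → ℚ × ℚ → Fin 9 → Set
  Separated (x , y) i (x' , y') j =
    (x + width ε δ i ≤ x') ⊎ (x' + width ε δ j ≤ x)
    ⊎ (y + height ε δ i ≤ y') ⊎ (y' + height ε δ j ≤ y)

InT6 : ℚ → ℚ → PatVec → Set
InT6 ε δ p = Packable ε δ p
  × lookup p zero ≡ 0
  × lookup p (suc zero) ≡ 0
  × lookup p (suc (suc zero)) ≡ 0
  × lookup p (suc (suc (suc zero))) ≡ 0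
  × lookup p (suc (suc (suc (suc zero)))) ≡ 0
  × ¬ (lookup p (suc (suc (suc (suc (suc zero))))) ≡ 0)

lam : Fin 9 → ℚ
lam zero = + 48 / 413
lam (suc zero) = + 48 / 413
lam (suc (suc zero)) = + 96 / 413
lam (suc (suc (suc zero))) = + 72 / 413
lam (suc (suc (suc (suc zero)))) = + 72 / 413
lam (suc (suc (suc (suc (suc zero))))) = + 144 / 413
lam (suc (suc (suc (suc (suc (suc zero)))))) = + 72 / 413
lam (suc (suc (suc (suc (suc (suc (suc zero))))))) = + 72 / 413
lam (suc (suc (suc (suc (suc (suc (suc (suc zero)))))))) = + 144 / 413

w : PatVec → ℚ
w (p1 ∷ p2 ∷ p3 ∷ p4 ∷ p5 ∷ p6 ∷ p7 ∷ p8 ∷ p9 ∷ []) =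
  lam (suc zero) * ℕ→ℚ p2
  + lam (suc (suc zero)) * ℕ→ℚ p3
  + lam (suc (suc (suc zero))) * ℕ→ℚ p4
  + lam (suc (suc (suc (suc zero)))) * ℕ→ℚ p5
  + lam (suc (suc (suc (suc (suc zero))))) * ℕ→ℚ p6
  + lam (suc (suc (suc (suc (suc (suc zero)))))) * ℕ→ℚ p7
  + lam (suc (suc (suc (suc (suc (suc (suc zero))))))) * ℕ→ℚ p8
  + lam (suc (suc (suc (suc (suc (suc (suc (suc zero)))))))) * ℕ→ℚ p9

MaxOverT6 : ℚ → ℚ → PatVec → Set
MaxOverT6 ε δ q = InT6 ε δ q × ((p : PatVec) → InT6 ε δ p → w p ≤ w q)

patA : PatVec
patA = 0 ∷ 0 ∷ 0 ∷ 0 ∷ 0 ∷ 2 ∷ 2 ∷ 0 ∷ 0 ∷ []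

patB : PatVec
patB = 0 ∷ 0 ∷ 0 ∷ 0 ∷ 0 ∷ 1 ∷ 4 ∷ 0 ∷ 0 ∷ []

{-# OPTIONS --safe #-}
-- Every item of a pattern in T₆ is taller than 1/3, so it crosses the line y = 1/3
-- or the line y = 2/3, and items of types 7, 8, 9 (taller than 1/2) cross y = 1/2.
-- Items crossing a common horizontal line are separated horizontally, so their
-- widths add up to at most 1.  A line carrying n items of type 6 and t "units"
-- (types 7, 8, 9 counting 1, 1, 2) therefore satisfies 3n + t ≤ 4, because
-- 2w₆, w₆ + 2w₇ and 5w₇ all exceed 1.  The three lines together give
-- 2p₆ + p₇ + p₈ + 2p₉ ≤ 6, and w(p) = 72/413 · (2p₆ + p₇ + p₈ + 2p₉); both
-- patterns reach 6 and have explicit packings.  Each inequality between affine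
-- expressions in ε and δ is decided by evaluating the minimum over a box of (ε, δ).
module Submission where

open import Defs
open import Data.Rational using (ℚ; 0ℚ; _<_)
open import Data.Product using (_×_; ∃-syntax)

open import Level using (0ℓ)
open import Function using (_∘_; id; Equivalence)
open import Data.Bool using (Bool; true; false; T; _∨_)
open import Data.Bool.Properties using (T-∨)
open import Data.Empty using (⊥-elim)
open import Data.Fin using (Fin; zero; suc; toℕ)
import Data.Fin as Fin
open import Data.Fin.Properties using (all?)
open import Data.Integer as ℤ using (+_)
import Data.Integer.Properties as ℤ
open import Data.List using (List; []; _∷_; _++_; foldr; map; concatMap; filter; length; allFin)
open import Data.List.Properties using (length-filter; length-tabulate)
open import Data.List.Relation.Unary.All as All using (All; []; _∷_)
open import Data.List.Relation.Unary.All.Properties as All using (all-filter)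
open import Data.List.Relation.Unary.AllPairs as AllPairs using (AllPairs; []; _∷_)
import Data.List.Relation.Unary.AllPairs.Properties as AllPairs
open import Data.List.Relation.Unary.Unique.Propositional using (Unique)
import Data.List.Relation.Unary.Unique.Propositional.Properties as Unique
open import Data.Nat as ℕ using (ℕ; zero; suc; s≤s; z≤n)
import Data.Nat.Properties as ℕ
import Data.Nat.Coprimality as Coprime
import Data.Nat.Tactic.RingSolver as ℕ-Solver
open import Data.Product using (_,_; proj₁; proj₂)
open import Data.Product.Properties using (≡-dec)
open import Data.Rational
  using (mkℚ; 1ℚ; ½; _+_; _-_; _*_; _/_; -_; _⊓_; _≤_; _≤?_; _<?_; *≤*; nonNegative; nonPositive)
open import Data.Rational.Properties
open import Data.Sum using (_⊎_; inj₁; inj₂; [_,_])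
import Data.Sum as Sum
open import Data.Vec using ([]; _∷_; lookup)
open import Algebra.Bundles using (CommutativeMonoid)
open import Relation.Binary.PropositionalEquality
  using (_≡_; _≢_; refl; sym; trans; cong; cong₂; subst; subst₂; module ≡-Reasoning)
open import Relation.Nullary using (Dec; ¬_; does; isYes)
open import Relation.Nullary.Decidable using (True; toWitness; from-yes; map′; _×-dec_; _⊎-dec_; T?)
open import Relation.Unary using (Pred; Decidable)
open import Relation.Unary.Properties using (∁?)
open import Tactic.RingSolver using (solve-∀)
open import Tactic.RingSolver.Core.AlmostCommutativeRing using (AlmostCommutativeRing; fromCommutativeRing)
open import Relation.Nullary.Decidable.Core using (dec⇒maybe)

ℚ-ring : AlmostCommutativeRing 0ℓ 0ℓ
ℚ-ring = fromCommutativeRing +-*-commutativeRing (λ q → dec⇒maybe (0ℚ ≟ q))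

⅓ ⅔ : ℚ
⅓ = + 1 / 3
⅔ = + 2 / 3

pattern type₆ = suc (suc (suc (suc (suc zero))))
pattern type₇ = suc type₆
pattern type₈ = suc type₇
pattern type₉ = suc type₈

T₆-shape : ℕ → ℕ → ℕ → ℕ → PatVec
T₆-shape a b c d = 0 ∷ 0 ∷ 0 ∷ 0 ∷ 0 ∷ a ∷ b ∷ c ∷ d ∷ []

T₆-units : ℕ → ℕ → ℕ → ℕ → ℕ
T₆-units a b c d = 2 ℕ.* a ℕ.+ (b ℕ.+ c ℕ.+ 2 ℕ.* d)

ℕ→ℚ-normal : ∀ n → ℕ→ℚ n ≡ mkℚ (+ n) 0 (Coprime.sym (Coprime.1-coprimeTo n))
ℕ→ℚ-normal n = normalize-coprime (Coprime.sym (Coprime.1-coprimeTo n))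

ℕ→ℚ-+ : ∀ m n → ℕ→ℚ (m ℕ.+ n) ≡ ℕ→ℚ m + ℕ→ℚ n
ℕ→ℚ-+ m n rewrite ℕ→ℚ-normal m | ℕ→ℚ-normal n =
  sym (cong₂ (λ x y → (x ℤ.+ y) / 1) (ℤ.*-identityʳ (+ m)) (ℤ.*-identityʳ (+ n)))

ℕ→ℚ-2* : ∀ n → ℕ→ℚ (2 ℕ.* n) ≡ ℕ→ℚ n + ℕ→ℚ n
ℕ→ℚ-2* n = trans (ℕ→ℚ-+ n (n ℕ.+ 0)) (cong (λ m → ℕ→ℚ n + ℕ→ℚ m) (ℕ.+-identityʳ n))

ℕ→ℚ-mono-≤ : ∀ {m n} → m ℕ.≤ n → ℕ→ℚ m ≤ ℕ→ℚ n
ℕ→ℚ-mono-≤ {m} {n} m≤n rewrite ℕ→ℚ-normal m | ℕ→ℚ-normal n =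
  *≤* (subst₂ ℤ._≤_ (sym (ℤ.*-identityʳ (+ m))) (sym (ℤ.*-identityʳ (+ n))) (ℤ.+≤+ m≤n))

module ListSum {c ℓ} (M : CommutativeMonoid c ℓ) where
  open CommutativeMonoid M
    using (Carrier; _≈_; _∙_; ∙-congˡ; assoc; identityˡ; commutativeSemigroup)
    renaming (ε to e; sym to ≈-sym; trans to ≈-trans)
  open import Algebra.Properties.CommutativeSemigroup commutativeSemigroup using (x∙yz≈y∙xz)

  ∑ : {A : Set} → (A → Carrier) → List A → Carrier
  ∑ f = foldr (λ x s → f x ∙ s) e

  ∑-++ : ∀ {A : Set} (f : A → Carrier) xs ys → ∑ f (xs ++ ys) ≈ ∑ f xs ∙ ∑ f ys
  ∑-++ f []       ys = ≈-sym (identityˡ _)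
  ∑-++ f (x ∷ xs) ys = ≈-trans (∙-congˡ (∑-++ f xs ys)) (≈-sym (assoc _ _ _))

  ∑-partition : ∀ {A : Set} {P : Pred A 0ℓ} (P? : Decidable P) (f : A → Carrier) xs →
                ∑ f xs ≈ ∑ f (filter P? xs) ∙ ∑ f (filter (∁? P?) xs)
  ∑-partition P? f []       = ≈-sym (identityˡ e)
  ∑-partition P? f (x ∷ xs) with does (P? x)
  ... | true  = ≈-trans (∙-congˡ (∑-partition P? f xs)) (≈-sym (assoc _ _ _))
  ... | false = ≈-trans (∙-congˡ (∑-partition P? f xs)) (x∙yz≈y∙xz _ _ _)

open ListSum ℕ.+-0-commutativeMonoid using () renaming (∑ to ∑ℕ; ∑-++ to ∑ℕ-++; ∑-partition to ∑ℕ-partition)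
open ListSum +-0-commutativeMonoid using () renaming (∑ to ∑ℚ; ∑-partition to ∑ℚ-partition)

module Intervals {A : Set} (x ℓ : A → ℚ) where

  Apart : A → A → Set
  Apart a b = x a + ℓ a ≤ x b ⊎ x b + ℓ b ≤ x a

  Within : ℚ → ℚ → A → Set
  Within L R a = L ≤ x a × x a + ℓ a ≤ R

  ∑-length-≤ : ∀ {L R} as → L ≤ R → All (Within L R) as → AllPairs Apart as → L + ∑ℚ ℓ as ≤ R
  ∑-length-≤ as = go (length as) as ℕ.≤-refl
    where
    regroup : ∀ p q r s → p + (q + (r + s)) ≡ p + r + q + s
    regroup = solve-∀ ℚ-ring

    -- The other intervals lie left or right of the first one; recurse on both groups.
    go : ∀ n as → length as ℕ.≤ n → ∀ {L R} → L ≤ R → All (Within L R) as → AllPairs Apart as →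
         L + ∑ℚ ℓ as ≤ R
    go _ [] _ {L} L≤R _ _ = subst (_≤ _) (sym (+-identityʳ L)) L≤R
    go (suc n) (a ∷ as) (s≤s |as|≤n) {L} {R} _ ((L≤a , a≤R) ∷ within) (apart ∷ apartPairs) = begin
      L + (ℓ a + ∑ℚ ℓ as)                       ≡⟨ cong (λ s → L + (ℓ a + s)) (∑ℚ-partition leftOf? ℓ as) ⟩
      L + (ℓ a + (∑ℚ ℓ lefts + ∑ℚ ℓ rights))   ≡⟨ regroup L (ℓ a) _ _ ⟩
      L + ∑ℚ ℓ lefts + ℓ a + ∑ℚ ℓ rights       ≤⟨ +-monoˡ-≤ _ (+-monoˡ-≤ (ℓ a) lefts-fit) ⟩
      x a + ℓ a + ∑ℚ ℓ rights                   ≤⟨ rights-fit ⟩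
      R                                         ∎
      where
      open ≤-Reasoning
      leftOf? : Decidable (λ b → x b + ℓ b ≤ x a)
      leftOf? b = x b + ℓ b ≤? x a
      lefts rights : List A
      lefts  = filter leftOf? as
      rights = filter (∁? leftOf?) as

      lefts-fit : L + ∑ℚ ℓ lefts ≤ x a
      lefts-fit = go n lefts (ℕ.≤-trans (length-filter leftOf? as) |as|≤n) L≤a
        (All.zipWith (λ ((L≤b , _) , b≤a) → L≤b , b≤a) (All.filter⁺ leftOf? within , all-filter leftOf? as))
        (AllPairs.filter⁺ leftOf? apartPairs)

      rights-fit : x a + ℓ a + ∑ℚ ℓ rights ≤ R
      rights-fit = go n rights (ℕ.≤-trans (length-filter (∁? leftOf?) as) |as|≤n) a≤R
        (All.zipWith (λ ((a≤b , (_ , b≤R)) , b≰a) → [ id , ⊥-elim ∘ b≰a ] a≤b , b≤R)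
          (All.filter⁺ (∁? leftOf?) (All.zip (apart , within)) , all-filter (∁? leftOf?) as))
        (AllPairs.filter⁺ (∁? leftOf?) apartPairs)

itemsOfType : (p : PatVec) → Fin 9 → List (Item p)
itemsOfType p i = map (i ,_) (allFin (lookup p i))

itemsOf : (p : PatVec) → List (Fin 9) → List (Item p)
itemsOf p = concatMap (itemsOfType p)

items : (p : PatVec) → List (Item p)
items p = itemsOf p (allFin 9)

All-itemsOf : ∀ p {Q : Item p → Set} {is} → All (λ i → ∀ k → Q (i , k)) is → All Q (itemsOf p is)
All-itemsOf p []         = []
All-itemsOf p (Qi ∷ Qis) = All.++⁺ (All.map⁺ (All.universal Qi _)) (All-itemsOf p Qis)

itemsOf-unique : ∀ p {is} → Unique is → Unique (itemsOf p is)
itemsOf-unique p []                 = []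
itemsOf-unique p (i∉is ∷ is-unique) =
  AllPairs.++⁺ (Unique.map⁺ (λ { refl → refl }) (Unique.allFin⁺ _)) (itemsOf-unique p is-unique)
    (All.map⁺ (All.universal (λ _ → All-itemsOf p (All.map (λ i≢j _ → i≢j ∘ cong proj₁) i∉is)) _))

count-itemsOfType : ∀ p (f : Fin 9 → ℕ) i → ∑ℕ (f ∘ proj₁) (itemsOfType p i) ≡ lookup p i ℕ.* f i
count-itemsOfType p f i =
  trans (copies (allFin (lookup p i))) (cong (ℕ._* f i) (length-tabulate {n = lookup p i} id))
  where
  copies : ∀ ks → ∑ℕ (f ∘ proj₁) (map {B = Item p} (i ,_) ks) ≡ length ks ℕ.* f i
  copies []       = refl
  copies (_ ∷ ks) = cong (f i ℕ.+_) (copies ks)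

count-itemsOf : ∀ p (f : Fin 9 → ℕ) is → ∑ℕ (f ∘ proj₁) (itemsOf p is) ≡ ∑ℕ (λ i → lookup p i ℕ.* f i) is
count-itemsOf p f []       = refl
count-itemsOf p f (i ∷ is) =
  trans (∑ℕ-++ (f ∘ proj₁) (itemsOfType p i) (itemsOf p is))
        (cong₂ ℕ._+_ (count-itemsOfType p f i) (count-itemsOf p f is))

-- Horizontal lines through a packing

top-above : ∀ {lo y h c} → lo ≤ y → c - lo < h → c < y + h
top-above {lo} {y} {h} {c} lo≤y c-lo<h = begin-strict
  c             ≡⟨ shift c lo ⟩
  c - lo + lo   <⟨ +-mono-<-≤ c-lo<h lo≤y ⟩
  h + y         ≡⟨ +-comm h y ⟩
  y + h         ∎
  where
  open ≤-Reasoning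
  shift : ∀ c lo → c ≡ c - lo + lo
  shift = solve-∀ ℚ-ring

bottom-below : ∀ {y h hi c} → y + h ≤ hi → hi - c < h → y < c
bottom-below {y} {h} {hi} {c} top≤hi hi-c<h = begin-strict
  y                       ≡⟨ shift y h hi c ⟩
  y + (hi - c) + (c - hi) <⟨ +-monoˡ-< (c - hi) (+-monoʳ-< y hi-c<h) ⟩
  y + h + (c - hi)        ≤⟨ +-monoˡ-≤ (c - hi) top≤hi ⟩
  hi + (c - hi)           ≡⟨ cancel hi c ⟩
  c                       ∎
  where
  open ≤-Reasoning
  shift : ∀ y h hi c → y ≡ y + (hi - c) + (c - hi)
  shift = solve-∀ ℚ-ring
  cancel : ∀ hi c → hi + (c - hi) ≡ c
  cancel = solve-∀ ℚ-ring

module HorizontalLine {ε δ p} (P : Packable ε δ p) where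

  x y wd ht : Item p → ℚ
  x it = proj₁ (proj₁ P it)
  y it = proj₂ (proj₁ P it)
  wd it = width ε δ (proj₁ it)
  ht it = height ε δ (proj₁ it)

  0≤y : ∀ it → 0ℚ ≤ y it
  0≤y it = proj₁ (proj₂ (proj₂ (proj₁ (proj₂ P) it)))

  y+ht≤1 : ∀ it → y it + ht it ≤ 1ℚ
  y+ht≤1 it = proj₂ (proj₂ (proj₂ (proj₁ (proj₂ P) it)))

  Crosses : ℚ → Item p → Set
  Crosses c it = y it < c × c < y it + ht it

  open Intervals x wd

  crossing⇒apart : ∀ {c a b} → Crosses c a → Crosses c b → a ≢ b → Apart a b
  crossing⇒apart {a = a} {b} (ya<c , c<a) (yb<c , c<b) a≢b with proj₂ (proj₂ P) a b a≢b
  ... | inj₁ a-left              = inj₁ a-left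
  ... | inj₂ (inj₁ b-left)       = inj₂ b-left
  ... | inj₂ (inj₂ (inj₁ a-low)) = ⊥-elim (<-irrefl refl (<-trans c<a (≤-<-trans a-low yb<c)))
  ... | inj₂ (inj₂ (inj₂ b-low)) = ⊥-elim (<-irrefl refl (<-trans c<b (≤-<-trans b-low ya<c)))

  ∑-width-≤1 : ∀ {c} its → Unique its → All (Crosses c) its → ∑ℚ wd its ≤ 1ℚ
  ∑-width-≤1 its unique crossing =
    subst (_≤ 1ℚ) (+-identityˡ _) (∑-length-≤ its (from-yes (0ℚ ≤? 1ℚ)) inside (apart crossing unique))
    where
    inside : All (Within 0ℚ 1ℚ) its
    inside = All.universal (λ it → let (0≤x , x+w≤1 , _) = proj₁ (proj₂ P) it in 0≤x , x+w≤1) its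

    apart : ∀ {its} → All (Crosses _) its → Unique its → AllPairs Apart its
    apart []       []        = []
    apart (ca ∷ cs) (a∉ ∷ u) = All.zipWith (λ (cb , a≢b) → crossing⇒apart ca cb a≢b) (cs , a∉) ∷ apart cs u

module LineCapacity {A B : ℚ} (0≤A : 0ℚ ≤ A) (0≤B : 0ℚ ≤ B) where

  load : ℕ → ℕ → ℚ
  load n t = ℕ→ℚ n * A + ℕ→ℚ t * B

  load-0 : load 0 0 ≡ 0ℚ
  load-0 = cong₂ _+_ (*-zeroˡ A) (*-zeroˡ B)

  load-+ : ∀ n t n′ t′ → load (n ℕ.+ n′) (t ℕ.+ t′) ≡ load n t + load n′ t′
  load-+ n t n′ t′ rewrite ℕ→ℚ-+ n n′ | ℕ→ℚ-+ t t′ = distrib (ℕ→ℚ n) (ℕ→ℚ n′) (ℕ→ℚ t) (ℕ→ℚ t′) A B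
    where
    distrib : ∀ n n′ t t′ a b → (n + n′) * a + (t + t′) * b ≡ (n * a + t * b) + (n′ * a + t′ * b)
    distrib = solve-∀ ℚ-ring

  load-mono : ∀ {n t n′ t′} → n ℕ.≤ n′ → t ℕ.≤ t′ → load n t ≤ load n′ t′
  load-mono n≤n′ t≤t′ =
    +-mono-≤ (*-monoʳ-≤-nonNeg A {{nonNegative 0≤A}} (ℕ→ℚ-mono-≤ n≤n′))
             (*-monoʳ-≤-nonNeg B {{nonNegative 0≤B}} (ℕ→ℚ-mono-≤ t≤t′))

  ∑-load-≤ : ∀ {X : Set} (n t : X → ℕ) (ℓ : X → ℚ) → (∀ x → load (n x) (t x) ≤ ℓ x) →
             ∀ xs → load (∑ℕ n xs) (∑ℕ t xs) ≤ ∑ℚ ℓ xs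
  ∑-load-≤ n t ℓ load≤ℓ []       = ≤-reflexive load-0
  ∑-load-≤ n t ℓ load≤ℓ (x ∷ xs) =
    subst (_≤ _) (sym (load-+ (n x) (t x) _ _)) (+-mono-≤ (load≤ℓ x) (∑-load-≤ n t ℓ load≤ℓ xs))

  exceeds : ∀ n₀ t₀ n t → 1ℚ < load n₀ t₀ → n₀ ℕ.≤ n → t₀ ℕ.≤ t → ¬ load n t ≤ 1ℚ
  exceeds _ _ _ _ over n₀≤n t₀≤t load≤1 =
    <-irrefl refl (<-≤-trans over (≤-trans (load-mono n₀≤n t₀≤t) load≤1))

  capacity : 1ℚ < load 2 0 → 1ℚ < load 1 2 → 1ℚ < load 0 5 →
             ∀ n t → load n t ≤ 1ℚ → 3 ℕ.* n ℕ.+ t ℕ.≤ 4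
  capacity over₂₀ _ _ (suc (suc n)) t load≤1 =
    ⊥-elim (exceeds 2 0 (2 ℕ.+ n) t over₂₀ (s≤s (s≤s z≤n)) z≤n load≤1)
  capacity _ over₁₂ _ 1 t load≤1 =
    s≤s (s≤s (s≤s (ℕ.s≤s⁻¹ (ℕ.≰⇒> λ 2≤t → exceeds 1 2 1 t over₁₂ ℕ.≤-refl 2≤t load≤1))))
  capacity _ _ over₀₅ 0 t load≤1 = ℕ.s≤s⁻¹ (ℕ.≰⇒> λ 5≤t → exceeds 0 5 0 t over₀₅ z≤n 5≤t load≤1)

-- Twice the first two bounds plus the third: 3 (2n + t) ≤ 20 < 3 · 7.
lines-bound : ∀ {n₁ t₁ n₂ t₂} → 3 ℕ.* n₁ ℕ.+ t₁ ℕ.≤ 4 → 3 ℕ.* n₂ ℕ.+ t₂ ℕ.≤ 4 → t₁ ℕ.+ t₂ ℕ.≤ 4 →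
              2 ℕ.* (n₁ ℕ.+ n₂) ℕ.+ (t₁ ℕ.+ t₂) ℕ.≤ 6
lines-bound {n₁} {t₁} {n₂} {t₂} line₁ line₂ line-½ = ℕ.s≤s⁻¹ (ℕ.*-cancelˡ-< 3 _ 7 (begin-strict
  3 ℕ.* (2 ℕ.* (n₁ ℕ.+ n₂) ℕ.+ (t₁ ℕ.+ t₂))
    ≡⟨ combine n₁ t₁ n₂ t₂ ⟩
  2 ℕ.* (3 ℕ.* n₁ ℕ.+ t₁) ℕ.+ 2 ℕ.* (3 ℕ.* n₂ ℕ.+ t₂) ℕ.+ (t₁ ℕ.+ t₂)
    ≤⟨ ℕ.+-mono-≤ (ℕ.+-mono-≤ (ℕ.*-monoʳ-≤ 2 line₁) (ℕ.*-monoʳ-≤ 2 line₂)) line-½ ⟩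
  20
    <⟨ ℕ.n<1+n 20 ⟩
  3 ℕ.* 7 ∎))
  where
  open ℕ.≤-Reasoning
  combine : ∀ n₁ t₁ n₂ t₂ → 3 ℕ.* (2 ℕ.* (n₁ ℕ.+ n₂) ℕ.+ (t₁ ℕ.+ t₂)) ≡
            2 ℕ.* (3 ℕ.* n₁ ℕ.+ t₁) ℕ.+ 2 ℕ.* (3 ℕ.* n₂ ℕ.+ t₂) ℕ.+ (t₁ ℕ.+ t₂)
  combine = ℕ-Solver.solve-∀

-- Affine expressions in ε and δ

record Affine : Set where
  constructor affine
  field
    constant coeffε coeffδ : ℚ

infixl 6 _⊕_ _⊖_
infixr 7 _⊛_
infix 4 _≤ᵃ_ _<ᵃ_

const : ℚ → Affine
const q = affine q 0ℚ 0ℚ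

εᵃ δᵃ : Affine
εᵃ = affine 0ℚ 1ℚ 0ℚ
δᵃ = affine 0ℚ 0ℚ 1ℚ

_⊕_ _⊖_ : Affine → Affine → Affine
affine a b c ⊕ affine a′ b′ c′ = affine (a + a′) (b + b′) (c + c′)
affine a b c ⊖ affine a′ b′ c′ = affine (a - a′) (b - b′) (c - c′)

_⊛_ : ℚ → Affine → Affine
k ⊛ affine a b c = affine (k * a) (k * b) (k * c)

-- δ₀ < 1/1200 keeps even the width of type 1 positive.
ε₀ δ₀ : ℚ
ε₀ = + 1 / 100
δ₀ = + 1 / 2000

lowerBound : Affine → ℚ
lowerBound (affine a b c) = a + (b ⊓ 0ℚ) * ε₀ + (c ⊓ 0ℚ) * δ₀

_≤ᵃ_ : Affine → Affine → Bool
f ≤ᵃ g = isYes (0ℚ ≤? lowerBound (g ⊖ f))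

-- Strictness comes from a positive minimum or from a margin of ε or δ, which are
-- positive on the box.
_<ᵃ_ : Affine → Affine → Bool
f <ᵃ g = isYes (0ℚ <? lowerBound (g ⊖ f)) ∨ (f ⊕ εᵃ ≤ᵃ g) ∨ (f ⊕ δᵃ ≤ᵃ g)

widthᵃ heightᵃ : Fin 9 → Affine
widthᵃ zero                         = affine (+ 1 / 4) 0ℚ (- ℕ→ℚ 300)
widthᵃ (suc zero)                   = affine (+ 1 / 4) 0ℚ (ℕ→ℚ 100)
widthᵃ (suc (suc zero))             = affine ½         0ℚ (ℕ→ℚ 200)
widthᵃ (suc (suc (suc zero)))       = affine (+ 1 / 4) 0ℚ (- ℕ→ℚ 30)
widthᵃ (suc (suc (suc (suc zero)))) = affine (+ 1 / 4) 0ℚ (ℕ→ℚ 10)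
widthᵃ type₆                        = affine ½         0ℚ (ℕ→ℚ 20)
widthᵃ type₇                        = affine (+ 1 / 4) 0ℚ (- ℕ→ℚ 3)
widthᵃ type₈                        = affine (+ 1 / 4) 0ℚ 1ℚ
widthᵃ type₉                        = affine ½         0ℚ (ℕ→ℚ 2)
heightᵃ zero                         = affine (+ 1 / 6) (- ℕ→ℚ 2) 0ℚ
heightᵃ (suc zero)                   = affine (+ 1 / 6) (- ℕ→ℚ 2) 0ℚ
heightᵃ (suc (suc zero))             = affine (+ 1 / 6) (- ℕ→ℚ 2) 0ℚ
heightᵃ (suc (suc (suc zero)))       = affine ⅓ 1ℚ 0ℚ
heightᵃ (suc (suc (suc (suc zero)))) = affine ⅓ 1ℚ 0ℚ
heightᵃ type₆                        = affine ⅓ 1ℚ 0ℚ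
heightᵃ type₇                        = affine ½ 1ℚ 0ℚ
heightᵃ type₈                        = affine ½ 1ℚ 0ℚ
heightᵃ type₉                        = affine ½ 1ℚ 0ℚ

private
  minus-δ : ∀ q k ε δ → q - k * δ ≡ q + 0ℚ * ε + (- k) * δ
  minus-δ = solve-∀ ℚ-ring
  plus-δ : ∀ q k ε δ → q + k * δ ≡ q + 0ℚ * ε + k * δ
  plus-δ = solve-∀ ℚ-ring
  plus-one-δ : ∀ q ε δ → q + δ ≡ q + 0ℚ * ε + 1ℚ * δ
  plus-one-δ = solve-∀ ℚ-ring
  minus-ε : ∀ q k ε δ → q - k * ε ≡ q + (- k) * ε + 0ℚ * δ
  minus-ε = solve-∀ ℚ-ring
  plus-one-ε : ∀ q ε δ → q + ε ≡ q + 1ℚ * ε + 0ℚ * δ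
  plus-one-ε = solve-∀ ℚ-ring

module Evaluation (ε δ : ℚ) where

  ⟦_⟧ : Affine → ℚ
  ⟦ affine a b c ⟧ = a + b * ε + c * δ

  ⟦const⟧ : ∀ q → ⟦ const q ⟧ ≡ q
  ⟦const⟧ q = expand q ε δ
    where
    expand : ∀ q ε δ → q + 0ℚ * ε + 0ℚ * δ ≡ q
    expand = solve-∀ ℚ-ring

  ⟦εᵃ⟧ : ⟦ εᵃ ⟧ ≡ ε
  ⟦εᵃ⟧ = expand ε δ
    where
    expand : ∀ ε δ → 0ℚ + 1ℚ * ε + 0ℚ * δ ≡ ε
    expand = solve-∀ ℚ-ring

  ⟦δᵃ⟧ : ⟦ δᵃ ⟧ ≡ δ
  ⟦δᵃ⟧ = expand ε δ
    where
    expand : ∀ ε δ → 0ℚ + 0ℚ * ε + 1ℚ * δ ≡ δ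
    expand = solve-∀ ℚ-ring

  ⟦⊕⟧ : ∀ f g → ⟦ f ⊕ g ⟧ ≡ ⟦ f ⟧ + ⟦ g ⟧
  ⟦⊕⟧ (affine a b c) (affine a′ b′ c′) = expand a b c a′ b′ c′ ε δ
    where
    expand : ∀ a b c a′ b′ c′ ε δ →
            (a + a′) + (b + b′) * ε + (c + c′) * δ ≡ (a + b * ε + c * δ) + (a′ + b′ * ε + c′ * δ)
    expand = solve-∀ ℚ-ring

  ⟦⊖⟧ : ∀ f g → ⟦ f ⊖ g ⟧ ≡ ⟦ f ⟧ - ⟦ g ⟧
  ⟦⊖⟧ (affine a b c) (affine a′ b′ c′) = expand a b c a′ b′ c′ ε δ
    where
    expand : ∀ a b c a′ b′ c′ ε δ →
            (a - a′) + (b - b′) * ε + (c - c′) * δ ≡ (a + b * ε + c * δ) - (a′ + b′ * ε + c′ * δ)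
    expand = solve-∀ ℚ-ring

  ⟦⊛⟧ : ∀ k f → ⟦ k ⊛ f ⟧ ≡ k * ⟦ f ⟧
  ⟦⊛⟧ k (affine a b c) = expand k a b c ε δ
    where
    expand : ∀ k a b c ε δ → k * a + k * b * ε + k * c * δ ≡ k * (a + b * ε + c * δ)
    expand = solve-∀ ℚ-ring

  width-⟦⟧ : ∀ i → width ε δ i ≡ ⟦ widthᵃ i ⟧
  width-⟦⟧ zero                         = minus-δ (+ 1 / 4) (ℕ→ℚ 300) ε δ
  width-⟦⟧ (suc zero)                   = plus-δ (+ 1 / 4) (ℕ→ℚ 100) ε δ
  width-⟦⟧ (suc (suc zero))             = plus-δ ½ (ℕ→ℚ 200) ε δ
  width-⟦⟧ (suc (suc (suc zero)))       = minus-δ (+ 1 / 4) (ℕ→ℚ 30) ε δ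
  width-⟦⟧ (suc (suc (suc (suc zero)))) = plus-δ (+ 1 / 4) (ℕ→ℚ 10) ε δ
  width-⟦⟧ type₆                        = plus-δ ½ (ℕ→ℚ 20) ε δ
  width-⟦⟧ type₇                        = minus-δ (+ 1 / 4) (ℕ→ℚ 3) ε δ
  width-⟦⟧ type₈                        = plus-one-δ (+ 1 / 4) ε δ
  width-⟦⟧ type₉                        = plus-δ ½ (ℕ→ℚ 2) ε δ

  height-⟦⟧ : ∀ i → height ε δ i ≡ ⟦ heightᵃ i ⟧
  height-⟦⟧ zero                         = minus-ε (+ 1 / 6) (ℕ→ℚ 2) ε δ
  height-⟦⟧ (suc zero)                   = minus-ε (+ 1 / 6) (ℕ→ℚ 2) ε δ
  height-⟦⟧ (suc (suc zero))             = minus-ε (+ 1 / 6) (ℕ→ℚ 2) ε δ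
  height-⟦⟧ (suc (suc (suc zero)))       = plus-one-ε ⅓ ε δ
  height-⟦⟧ (suc (suc (suc (suc zero)))) = plus-one-ε ⅓ ε δ
  height-⟦⟧ type₆                        = plus-one-ε ⅓ ε δ
  height-⟦⟧ type₇                        = plus-one-ε ½ ε δ
  height-⟦⟧ type₈                        = plus-one-ε ½ ε δ
  height-⟦⟧ type₉                        = plus-one-ε ½ ε δ

scaled-min-≤ : ∀ {x m} b → 0ℚ ≤ x → x ≤ m → (b ⊓ 0ℚ) * m ≤ b * x
scaled-min-≤ {x} {m} b 0≤x x≤m = begin
  (b ⊓ 0ℚ) * m  ≤⟨ *-monoˡ-≤-nonPos (b ⊓ 0ℚ) {{nonPositive (p⊓q≤q b 0ℚ)}} x≤m ⟩
  (b ⊓ 0ℚ) * x  ≤⟨ *-monoʳ-≤-nonNeg x {{nonNegative 0≤x}} (p⊓q≤p b 0ℚ) ⟩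
  b * x         ∎
  where open ≤-Reasoning

0≤q-p⇒p≤q : ∀ {p q} → 0ℚ ≤ q - p → p ≤ q
0≤q-p⇒p≤q {p} {q} 0≤q-p = subst₂ _≤_ (+-identityˡ p) (cancel p q) (+-monoˡ-≤ p 0≤q-p)
  where
  cancel : ∀ p q → q - p + p ≡ q
  cancel = solve-∀ ℚ-ring

0<q-p⇒p<q : ∀ {p q} → 0ℚ < q - p → p < q
0<q-p⇒p<q {p} {q} 0<q-p = subst₂ _<_ (+-identityˡ p) (cancel p q) (+-monoˡ-< p 0<q-p)
  where
  cancel : ∀ p q → q - p + p ≡ q
  cancel = solve-∀ ℚ-ring

record InBox (ε δ : ℚ) : Set where
  field
    0<ε  : 0ℚ < ε
    ε≤ε₀ : ε ≤ ε₀
    0<δ  : 0ℚ < δ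
    δ≤δ₀ : δ ≤ δ₀

module Soundness {ε δ : ℚ} (box : InBox ε δ) where
  open InBox box
  open Evaluation ε δ

  lowerBound-≤ : ∀ f → lowerBound f ≤ ⟦ f ⟧
  lowerBound-≤ (affine a b c) =
    +-mono-≤ (+-monoʳ-≤ a (scaled-min-≤ b (<⇒≤ 0<ε) ε≤ε₀)) (scaled-min-≤ c (<⇒≤ 0<δ) δ≤δ₀)

  lowerBound-≤-difference : ∀ f g → lowerBound (g ⊖ f) ≤ ⟦ g ⟧ - ⟦ f ⟧
  lowerBound-≤-difference f g = subst (lowerBound (g ⊖ f) ≤_) (⟦⊖⟧ g f) (lowerBound-≤ (g ⊖ f))

  ≤ᵃ-sound : ∀ f g → T (f ≤ᵃ g) → ⟦ f ⟧ ≤ ⟦ g ⟧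
  ≤ᵃ-sound f g checked =
    0≤q-p⇒p≤q (≤-trans (toWitness {a? = 0ℚ ≤? lowerBound (g ⊖ f)} checked) (lowerBound-≤-difference f g))

  shifted-< : ∀ f g s → 0ℚ < ⟦ s ⟧ → T (f ⊕ s ≤ᵃ g) → ⟦ f ⟧ < ⟦ g ⟧
  shifted-< f g s 0<s checked = begin-strict
    ⟦ f ⟧          ≡⟨ sym (+-identityʳ ⟦ f ⟧) ⟩
    ⟦ f ⟧ + 0ℚ     <⟨ +-monoʳ-< ⟦ f ⟧ 0<s ⟩
    ⟦ f ⟧ + ⟦ s ⟧  ≡⟨ sym (⟦⊕⟧ f s) ⟩
    ⟦ f ⊕ s ⟧      ≤⟨ ≤ᵃ-sound (f ⊕ s) g checked ⟩
    ⟦ g ⟧          ∎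
    where open ≤-Reasoning

  <ᵃ-sound : ∀ f g → T (f <ᵃ g) → ⟦ f ⟧ < ⟦ g ⟧
  <ᵃ-sound f g checked with Equivalence.to T-∨ checked
  ... | inj₁ positive =
    0<q-p⇒p<q (<-≤-trans (toWitness {a? = 0ℚ <? lowerBound (g ⊖ f)} positive) (lowerBound-≤-difference f g))
  ... | inj₂ shifted =
    [ shifted-< f g εᵃ (subst (0ℚ <_) (sym ⟦εᵃ⟧) 0<ε) , shifted-< f g δᵃ (subst (0ℚ <_) (sym ⟦δᵃ⟧) 0<δ) ]
      (Equivalence.to T-∨ shifted)

-- Packings

-- The lower-left corner of copy k of item type i; a plain ℕ copy index lets one
-- formula place all copies of a type.
Placement : Set
Placement = Fin 9 → ℕ → Affine × Affine

all-items? : ∀ p {P : Item p → Set} → (∀ it → Dec (P it)) → Dec (∀ it → P it)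
all-items? _ P? =
  map′ (λ all-P (i , k) → all-P i k) (λ all-P i k → all-P (i , k)) (all? λ i → all? λ k → P? (i , k))

module _ (π : Placement) (p : PatVec) where

  xᵃ yᵃ : Item p → Affine
  xᵃ (i , k) = proj₁ (π i (toℕ k))
  yᵃ (i , k) = proj₂ (π i (toℕ k))

  InsideCertificate : Item p → Set
  InsideCertificate it@(i , _) =
    T (const 0ℚ ≤ᵃ xᵃ it) × T (xᵃ it ⊕ widthᵃ i ≤ᵃ const 1ℚ) ×
    T (const 0ℚ ≤ᵃ yᵃ it) × T (yᵃ it ⊕ heightᵃ i ≤ᵃ const 1ℚ)

  ApartCertificate : Item p → Item p → Set
  ApartCertificate a@(i , _) b@(j , _) =
    T (xᵃ a ⊕ widthᵃ i ≤ᵃ xᵃ b) ⊎ T (xᵃ b ⊕ widthᵃ j ≤ᵃ xᵃ a) ⊎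
    T (yᵃ a ⊕ heightᵃ i ≤ᵃ yᵃ b) ⊎ T (yᵃ b ⊕ heightᵃ j ≤ᵃ yᵃ a)

  Certified : Set
  Certified = (∀ it → InsideCertificate it) × (∀ a b → a ≡ b ⊎ ApartCertificate a b)

  certified? : Dec Certified
  certified? =
    all-items? p (λ _ → T? _ ×-dec T? _ ×-dec T? _ ×-dec T? _) ×-dec
    all-items? p λ a → all-items? p λ b →
      ≡-dec Fin._≟_ Fin._≟_ a b ⊎-dec T? _ ⊎-dec T? _ ⊎-dec T? _ ⊎-dec T? _

module CertifiedPacking {ε δ : ℚ} (box : InBox ε δ) (π : Placement) (p : PatVec) where
  open Evaluation ε δ
  open Soundness box

  x y : Item p → ℚ
  x it = ⟦ xᵃ π p it ⟧
  y it = ⟦ yᵃ π p it ⟧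

  edge-≤ : ∀ u d v {q} → ⟦ d ⟧ ≡ q → T (u ⊕ d ≤ᵃ v) → ⟦ u ⟧ + q ≤ ⟦ v ⟧
  edge-≤ u d v ⟦d⟧≡q checked =
    subst (_≤ ⟦ v ⟧) (trans (⟦⊕⟧ u d) (cong (_+_ ⟦ u ⟧) ⟦d⟧≡q)) (≤ᵃ-sound (u ⊕ d) v checked)

  inside-sound : ∀ it → InsideCertificate π p it →
                 0ℚ ≤ x it × x it + width ε δ (proj₁ it) ≤ 1ℚ ×
                 0ℚ ≤ y it × y it + height ε δ (proj₁ it) ≤ 1ℚ
  inside-sound it@(i , _) (0≤x , x+w≤1 , 0≤y , y+h≤1) =
    subst (_≤ x it) (⟦const⟧ 0ℚ) (≤ᵃ-sound (const 0ℚ) (xᵃ π p it) 0≤x) ,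
    subst (x it + width ε δ i ≤_) (⟦const⟧ 1ℚ)
      (edge-≤ (xᵃ π p it) (widthᵃ i) (const 1ℚ) (sym (width-⟦⟧ i)) x+w≤1) ,
    subst (_≤ y it) (⟦const⟧ 0ℚ) (≤ᵃ-sound (const 0ℚ) (yᵃ π p it) 0≤y) ,
    subst (y it + height ε δ i ≤_) (⟦const⟧ 1ℚ)
      (edge-≤ (yᵃ π p it) (heightᵃ i) (const 1ℚ) (sym (height-⟦⟧ i)) y+h≤1)

  apart-sound : ∀ a b → a ≢ b → a ≡ b ⊎ ApartCertificate π p a b →
                x a + width ε δ (proj₁ a) ≤ x b ⊎ x b + width ε δ (proj₁ b) ≤ x a ⊎
                y a + height ε δ (proj₁ a) ≤ y b ⊎ y b + height ε δ (proj₁ b) ≤ y a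
  apart-sound _ _ a≢b (inj₁ a≡b) = ⊥-elim (a≢b a≡b)
  apart-sound a@(i , _) b@(j , _) _ (inj₂ apart) =
     Sum.map (edge-≤ (xᵃ π p a) (widthᵃ i) (xᵃ π p b) (sym (width-⟦⟧ i)))
    (Sum.map (edge-≤ (xᵃ π p b) (widthᵃ j) (xᵃ π p a) (sym (width-⟦⟧ j)))
    (Sum.map (edge-≤ (yᵃ π p a) (heightᵃ i) (yᵃ π p b) (sym (height-⟦⟧ i)))
             (edge-≤ (yᵃ π p b) (heightᵃ j) (yᵃ π p a) (sym (height-⟦⟧ j)))))
      apart

  certified-packable : True (certified? π p) → Packable ε δ p
  certified-packable certified =
    (λ it → x it , y it) ,
    (λ it → inside-sound it (proj₁ certificate it)) ,
    (λ a b a≢b → apart-sound a b a≢b (proj₂ certificate a b))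
    where
    certificate : Certified π p
    certificate = toWitness {a? = certified? π p} certified

origin : Affine × Affine
origin = const 0ℚ , const 0ℚ

placementA : Placement
placementA type₆ zero    = origin
placementA type₆ (suc _) = const 1ℚ ⊖ widthᵃ type₆ , const 1ℚ ⊖ heightᵃ type₆
placementA type₇ zero    = const 0ℚ , heightᵃ type₆
placementA type₇ (suc _) = widthᵃ type₆ , const 0ℚ
placementA _     _       = origin

placementB : Placement
placementB type₇ k = ℕ→ℚ k ⊛ widthᵃ type₇ , const 1ℚ ⊖ heightᵃ type₇
placementB _     _ = origin

module Packings {ε δ : ℚ} (box : InBox ε δ) where
  open CertifiedPacking box using (certified-packable)

  -- Each `_` is the certificate, found by evaluating `certified?`.
  patA∈T₆ : InT6 ε δ patA
  patA∈T₆ = certified-packable placementA patA _ , refl , refl , refl , refl , refl , λ ()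

  patB∈T₆ : InT6 ε δ patB
  patB∈T₆ = certified-packable placementB patB _ , refl , refl , refl , refl , refl , λ ()

-- The upper bound over T₆

sixes units : Fin 9 → ℕ
sixes type₆ = 1
sixes _     = 0
units type₇ = 1
units type₈ = 1
units type₉ = 2
units _     = 0

tall-types : List (Fin 9)
tall-types = type₇ ∷ type₈ ∷ type₉ ∷ []

loadᵃ : ℕ → ℕ → Affine
loadᵃ n t = ℕ→ℚ n ⊛ widthᵃ type₆ ⊕ ℕ→ℚ t ⊛ widthᵃ type₇

module ItemBounds {ε δ : ℚ} (box : InBox ε δ) where
  open Evaluation ε δ
  open Soundness box

  width-nonneg : ∀ i → 0ℚ ≤ width ε δ i
  width-nonneg i = subst₂ _≤_ (⟦const⟧ 0ℚ) (sym (width-⟦⟧ i))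
    (≤ᵃ-sound (const 0ℚ) (widthᵃ i) (from-yes (all? λ j → T? (const 0ℚ ≤ᵃ widthᵃ j)) i))

  open LineCapacity (width-nonneg type₆) (width-nonneg type₇) public

  load-⟦⟧ : ∀ n t → ⟦ loadᵃ n t ⟧ ≡ load n t
  load-⟦⟧ n t = begin
    ⟦ loadᵃ n t ⟧
      ≡⟨ ⟦⊕⟧ (ℕ→ℚ n ⊛ widthᵃ type₆) (ℕ→ℚ t ⊛ widthᵃ type₇) ⟩
    ⟦ ℕ→ℚ n ⊛ widthᵃ type₆ ⟧ + ⟦ ℕ→ℚ t ⊛ widthᵃ type₇ ⟧
      ≡⟨ cong₂ _+_ (⟦⊛⟧ (ℕ→ℚ n) (widthᵃ type₆)) (⟦⊛⟧ (ℕ→ℚ t) (widthᵃ type₇)) ⟩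
    ℕ→ℚ n * ⟦ widthᵃ type₆ ⟧ + ℕ→ℚ t * ⟦ widthᵃ type₇ ⟧
      ≡⟨ sym (cong₂ (λ A B → ℕ→ℚ n * A + ℕ→ℚ t * B) (width-⟦⟧ type₆) (width-⟦⟧ type₇)) ⟩
    load n t
      ∎
    where open ≡-Reasoning

  load-≤-width : ∀ i → load (sixes i) (units i) ≤ width ε δ i
  load-≤-width i = subst₂ _≤_ (load-⟦⟧ (sixes i) (units i)) (sym (width-⟦⟧ i))
    (≤ᵃ-sound (loadᵃ (sixes i) (units i)) (widthᵃ i)
      (from-yes (all? λ j → T? (loadᵃ (sixes j) (units j) ≤ᵃ widthᵃ j)) i))

  overloaded : ∀ n t → T (const 1ℚ <ᵃ loadᵃ n t) → 1ℚ < load n t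
  overloaded n t checked = subst₂ _<_ (⟦const⟧ 1ℚ) (load-⟦⟧ n t) (<ᵃ-sound (const 1ℚ) (loadᵃ n t) checked)

  height-above : ∀ q i → T (const q <ᵃ heightᵃ i) → q < height ε δ i
  height-above q i checked =
    subst₂ _<_ (⟦const⟧ q) (sym (height-⟦⟧ i)) (<ᵃ-sound (const q) (heightᵃ i) checked)

module T₆Bound {ε δ : ℚ} (box : InBox ε δ) {a b c d : ℕ} (P : Packable ε δ (T₆-shape a b c d)) where
  open ItemBounds box
  open HorizontalLine {p = T₆-shape a b c d} P

  height>⅓ : ∀ it → ⅓ < ht it
  height>⅓ (zero , ())
  height>⅓ (suc zero , ())
  height>⅓ (suc (suc zero) , ())
  height>⅓ (suc (suc (suc zero)) , ())
  height>⅓ (suc (suc (suc (suc zero))) , ())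
  height>⅓ (type₆ , _) = height-above ⅓ type₆ _
  height>⅓ (type₇ , _) = height-above ⅓ type₇ _
  height>⅓ (type₈ , _) = height-above ⅓ type₈ _
  height>⅓ (type₉ , _) = height-above ⅓ type₉ _

  crosses-⅓ : ∀ it → y it < ⅓ → Crosses ⅓ it
  crosses-⅓ it y<⅓ = y<⅓ , top-above (0≤y it) (height>⅓ it)

  crosses-⅔ : ∀ it → ¬ y it < ⅓ → Crosses ⅔ it
  crosses-⅔ it y≮⅓ = bottom-below (y+ht≤1 it) (height>⅓ it) , top-above (≮⇒≥ y≮⅓) (height>⅓ it)

  crosses-½ : ∀ it → ½ < ht it → Crosses ½ it
  crosses-½ it ½<h = bottom-below (y+ht≤1 it) ½<h , top-above (0≤y it) ½<h

  sixesIn unitsIn : List (Item (T₆-shape a b c d)) → ℕ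
  sixesIn = ∑ℕ (sixes ∘ proj₁)
  unitsIn = ∑ℕ (units ∘ proj₁)

  line-capacity : ∀ {c} its → Unique its → All (Crosses c) its → 3 ℕ.* sixesIn its ℕ.+ unitsIn its ℕ.≤ 4
  line-capacity its unique crossing =
    capacity (overloaded 2 0 _) (overloaded 1 2 _) (overloaded 0 5 _) (sixesIn its) (unitsIn its)
      (≤-trans (∑-load-≤ (sixes ∘ proj₁) (units ∘ proj₁) wd (load-≤-width ∘ proj₁) its)
               (∑-width-≤1 its unique crossing))

  below? : Decidable (λ it → y it < ⅓)
  below? it = y it <? ⅓

  all-items lower upper tall : List (Item (T₆-shape a b c d))
  all-items = items (T₆-shape a b c d)
  lower     = filter below? all-items
  upper     = filter (∁? below?) all-items
  tall      = itemsOf (T₆-shape a b c d) tall-types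

  all-items-unique : Unique all-items
  all-items-unique = itemsOf-unique (T₆-shape a b c d) (Unique.allFin⁺ 9)

  lower-capacity : 3 ℕ.* sixesIn lower ℕ.+ unitsIn lower ℕ.≤ 4
  lower-capacity = line-capacity lower (Unique.filter⁺ below? all-items-unique)
    (All.map (λ {it} → crosses-⅓ it) (all-filter below? all-items))

  upper-capacity : 3 ℕ.* sixesIn upper ℕ.+ unitsIn upper ℕ.≤ 4
  upper-capacity = line-capacity upper (Unique.filter⁺ (∁? below?) all-items-unique)
    (All.map (λ {it} → crosses-⅔ it) (all-filter (∁? below?) all-items))

  tall-units-≤4 : unitsIn tall ℕ.≤ 4
  tall-units-≤4 = ℕ.≤-trans (ℕ.m≤n+m (unitsIn tall) (3 ℕ.* sixesIn tall)) (line-capacity tall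
    (itemsOf-unique (T₆-shape a b c d) {tall-types} (((λ ()) ∷ (λ ()) ∷ []) ∷ ((λ ()) ∷ []) ∷ [] ∷ []))
    (All-itemsOf (T₆-shape a b c d) {Crosses ½}
      ((λ k → crosses-½ (type₇ , k) (height-above ½ type₇ _)) ∷
       (λ k → crosses-½ (type₈ , k) (height-above ½ type₈ _)) ∷
       (λ k → crosses-½ (type₉ , k) (height-above ½ type₉ _)) ∷ [])))

  sixes-total : sixesIn lower ℕ.+ sixesIn upper ≡ a
  sixes-total = trans (sym (∑ℕ-partition below? (sixes ∘ proj₁) all-items))
                      (trans (count-itemsOf (T₆-shape a b c d) sixes (allFin 9)) (normalise a b c d))
    where
    normalise : ∀ a b c d → a ℕ.* 1 ℕ.+ (b ℕ.* 0 ℕ.+ (c ℕ.* 0 ℕ.+ (d ℕ.* 0 ℕ.+ 0))) ≡ a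
    normalise = ℕ-Solver.solve-∀

  units-total : unitsIn lower ℕ.+ unitsIn upper ≡ b ℕ.+ c ℕ.+ 2 ℕ.* d
  units-total = trans (sym (∑ℕ-partition below? (units ∘ proj₁) all-items))
                      (trans (count-itemsOf (T₆-shape a b c d) units (allFin 9)) (normalise a b c d))
    where
    normalise : ∀ a b c d → a ℕ.* 0 ℕ.+ (b ℕ.* 1 ℕ.+ (c ℕ.* 1 ℕ.+ (d ℕ.* 2 ℕ.+ 0))) ≡ b ℕ.+ c ℕ.+ 2 ℕ.* d
    normalise = ℕ-Solver.solve-∀

  tall-units : unitsIn tall ≡ b ℕ.+ c ℕ.+ 2 ℕ.* d
  tall-units = trans (count-itemsOf (T₆-shape a b c d) units tall-types) (normalise b c d)
    where
    normalise : ∀ b c d → b ℕ.* 1 ℕ.+ (c ℕ.* 1 ℕ.+ (d ℕ.* 2 ℕ.+ 0)) ≡ b ℕ.+ c ℕ.+ 2 ℕ.* d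
    normalise = ℕ-Solver.solve-∀

  T₆-units-≤6 : T₆-units a b c d ℕ.≤ 6
  T₆-units-≤6 = subst₂ (λ n t → 2 ℕ.* n ℕ.+ t ℕ.≤ 6) sixes-total units-total
    (lines-bound {sixesIn lower} {unitsIn lower} {sixesIn upper} {unitsIn upper}
      lower-capacity upper-capacity
      (subst (ℕ._≤ 4) (trans tall-units (sym units-total)) tall-units-≤4))

w-T₆ : ∀ a b c d → w (T₆-shape a b c d) ≡ + 72 / 413 * ℕ→ℚ (T₆-units a b c d)
w-T₆ a b c d = begin
  w (T₆-shape a b c d)
    ≡⟨ collect (ℕ→ℚ a) (ℕ→ℚ b) (ℕ→ℚ c) (ℕ→ℚ d) ⟩
  + 72 / 413 * ((ℕ→ℚ a + ℕ→ℚ a) + ((ℕ→ℚ b + ℕ→ℚ c) + (ℕ→ℚ d + ℕ→ℚ d)))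
    ≡⟨ cong (+ 72 / 413 *_) (sym embed) ⟩
  + 72 / 413 * ℕ→ℚ (T₆-units a b c d)
    ∎
  where
  open ≡-Reasoning
  collect : ∀ A B C D →
    lam (suc zero) * ℕ→ℚ 0 + lam (suc (suc zero)) * ℕ→ℚ 0 + lam (suc (suc (suc zero))) * ℕ→ℚ 0
    + lam (suc (suc (suc (suc zero)))) * ℕ→ℚ 0
    + lam type₆ * A + lam type₇ * B + lam type₈ * C + lam type₉ * D
    ≡ + 72 / 413 * ((A + A) + ((B + C) + (D + D)))
  collect = solve-∀ ℚ-ring
  embed : ℕ→ℚ (T₆-units a b c d) ≡ (ℕ→ℚ a + ℕ→ℚ a) + ((ℕ→ℚ b + ℕ→ℚ c) + (ℕ→ℚ d + ℕ→ℚ d))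
  embed = trans (ℕ→ℚ-+ (2 ℕ.* a) _)
    (cong₂ _+_ (ℕ→ℚ-2* a) (trans (ℕ→ℚ-+ (b ℕ.+ c) _) (cong₂ _+_ (ℕ→ℚ-+ b c) (ℕ→ℚ-2* d))))

T₆-w-≤-w-patA : ∀ {ε δ} → InBox ε δ → ∀ p → InT6 ε δ p → w p ≤ w patA
T₆-w-≤-w-patA box (_ ∷ _ ∷ _ ∷ _ ∷ _ ∷ a ∷ b ∷ c ∷ d ∷ []) (P , refl , refl , refl , refl , refl , _) =
  begin
    w (T₆-shape a b c d)                 ≡⟨ w-T₆ a b c d ⟩
    + 72 / 413 * ℕ→ℚ (T₆-units a b c d) ≤⟨ *-monoˡ-≤-nonNeg (+ 72 / 413) (ℕ→ℚ-mono-≤ units≤6) ⟩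
    + 72 / 413 * ℕ→ℚ (T₆-units 2 2 0 0) ≡⟨ sym (w-T₆ 2 2 0 0) ⟩
    w patA                               ∎
  where
  open ≤-Reasoning
  units≤6 : T₆-units a b c d ℕ.≤ 6
  units≤6 = T₆Bound.T₆-units-≤6 box P

lemma5 : ∃[ ε₀ ] ∃[ δ₀ ] (0ℚ < ε₀ × 0ℚ < δ₀ ×
           ((ε δ : ℚ) → 0ℚ < ε → ε < ε₀ → 0ℚ < δ → δ < δ₀ →
             MaxOverT6 ε δ patA × MaxOverT6 ε δ patB))
lemma5 = ε₀ , δ₀ , from-yes (0ℚ <? ε₀) , from-yes (0ℚ <? δ₀) , λ ε δ 0<ε ε<ε₀ 0<δ δ<δ₀ →
  let box = record { 0<ε = 0<ε ; ε≤ε₀ = <⇒≤ ε<ε₀ ; 0<δ = 0<δ ; δ≤δ₀ = <⇒≤ δ<δ₀ } in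
  -- w patA and w patB evaluate to the same rational, 432/413.
  (Packings.patA∈T₆ box , T₆-w-≤-w-patA box) , (Packings.patB∈T₆ box , T₆-w-≤-w-patA box)
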